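{- Let $\mathcal{T}$ be a $\mathcal{TEL}^{\bigcirc}_{\mathit{lin}}$-TBox all of whose role names are rigid, and let $\Gamma_\mathcal{T}$ be as in the context. For any concept names $A,B$ occurring in $\mathcal{T}$ and any $n\in\mathbb{Z}$: $\mathcal{T}\models A\sqsubseteq\bigcirc^nB$ if and only if there exists $w\in L_{\Gamma_\mathcal{T}}(\mathcal{N}_{AB})$ with $\#c(w)-\#d(w)=n$.
   Context: A $\mathcal{TEL}^{\bigcirc}_{\mathit{lin}}$-TBox is a finite set of concept inclusions $A\sqsubseteq\bigcirc^nB$, $\exists r.A\sqsubseteq B$, $A\sqsubseteq\exists r.B$ ($A,B$ concept names, $r$ a role name, $n\in\mathbb{Z}$, $\bigcirc^0B=B$). Semantics: an interpretation is a family $(\mathcal{I}_i)_{i\in\mathbb{Z}}$ of classical DL interpretations over a common domain, rigid role names interpreted identically at all $i$; $(\bigcirc^nA)^{i}=A^{i+n}$, $(\exists r.A)^i=\{d\mid\exists e\in A^i,(d,e)\in r^i\}$; $C\sqsubseteq D$ holds if $C^i\subseteq D^i$ for all $i$; $\models$ is entailment. $\Gamma_\mathcal{T}=(N_\mathcal{T},\{c,d\},R_\mathcal{T})$ is the context-free grammar with $N_\mathcal{T}=\{\mathcal{N}_{AB}\mid A,B\text{ concept names of }\mathcal{T}\}$ and rules exactly: $\mathcal{N}_{AB}\to\varepsilon$ if $A\sqsubseteq B\in\mathcal{T}$ or $A=B$; $\mathcal{N}_{AB}\to c^n$ if $A\sqsubseteq\bigcirc^nB\in\mathcal{T}$, $n>0$;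 $\mathcal{N}_{AB}\to d^{|n|}$ if $A\sqsubseteq\bigcirc^nB\in\mathcal{T}$, $n<0$; $\mathcal{N}_{AB}\to\mathcal{N}_{CD}$ if $A\sqsubseteq\exists r.C\in\mathcal{T}$ and $\exists r.D\sqsubseteq B\in\mathcal{T}$ for some $r$; $\mathcal{N}_{AB}\to\mathcal{N}_{AC}\mathcal{N}_{CB}$ for all concept names $A,B,C$ of $\mathcal{T}$. $L_\Gamma(\mathcal{N})$ is the language generated from $\mathcal{N}$; $\#x(w)$ counts occurrences of $x$ in $w$. -}

module Defs where

open import Data.Nat using (ℕ; suc)
open import Data.Integer using (ℤ; +_; -[1+_]; _+_; _-_)
open import Data.List using (List; []; _∷_; _++_; replicate; concatMap; length; filter)
open import Data.List.Membership.Propositional using (_∈_)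
open import Data.Product using (Σ; _×_)
open import Relation.Binary.PropositionalEquality using (_≡_)

ConceptName : Set
ConceptName = ℕ

RoleName : Set
RoleName = ℕ

-- TEL^○_lin concept inclusions.
--   A ⊑○[ n ] B   is  A ⊑ ○^n B   (n ∈ ℤ; n = 0 gives A ⊑ B)
--   ∃[ r ] A ⊑ B  is  ∃r.A ⊑ B
--   A ⊑∃[ r ] B   is  A ⊑ ∃r.B
data Axiom : Set where
  _⊑○[_]_ : ConceptName → ℤ → ConceptName → Axiom
  ∃[_]_⊑_ : RoleName → ConceptName → ConceptName → Axiom
  _⊑∃[_]_ : ConceptName → RoleName → ConceptName → Axiom

TBox : Set
TBox = List Axiom

conceptNamesOf : Axiom → List ConceptName
conceptNamesOf (A ⊑○[ n ] B) = A ∷ B ∷ []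
conceptNamesOf (∃[ r ] A ⊑ B) = A ∷ B ∷ []
conceptNamesOf (A ⊑∃[ r ] B) = A ∷ B ∷ []

OccursIn : ConceptName → TBox → Set
OccursIn A 𝒯 = A ∈ concatMap conceptNamesOf 𝒯

-- Semantics (all role names rigid: roles do not depend on time)

record Interpretation : Set₁ where
  field
    Δ    : Set
    conc : ConceptName → ℤ → Δ → Set
    role : RoleName → Δ → Δ → Set

open Interpretation

_⊨ax_ : Interpretation → Axiom → Set
I ⊨ax (A ⊑○[ n ] B) = ∀ (i : ℤ) (x : Δ I) → conc I A i x → conc I B (i + n) x
I ⊨ax (∃[ r ] A ⊑ B) = ∀ (i : ℤ) (x y : Δ I) → role I r x y → conc I A i y → conc I B i x
I ⊨ax (A ⊑∃[ r ] B) = ∀ (i : ℤ) (x : Δ I) → conc I A i x → Σ (Δ I) λ y → role I r x y × conc I B i y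

_⊨TBox_ : Interpretation → TBox → Set
I ⊨TBox 𝒯 = ∀ {α} → α ∈ 𝒯 → I ⊨ax α

_⊨_ : TBox → Axiom → Set₁
𝒯 ⊨ α = ∀ (I : Interpretation) → I ⊨TBox 𝒯 → I ⊨ax α

data Letter : Set where
  c d : Letter

-- Gen 𝒯 A B w  :  w ∈ L_{Γ_𝒯}(𝒩_{AB})  (derivation trees of Γ_𝒯)
data Gen (𝒯 : TBox) : ConceptName → ConceptName → List Letter → Set where
  ax-ε   : ∀ {A B} → (A ⊑○[ + 0 ] B) ∈ 𝒯 → Gen 𝒯 A B []
  refl-ε : ∀ {A} → OccursIn A 𝒯 → Gen 𝒯 A A []
  ax-c   : ∀ {A B k} → (A ⊑○[ + suc k ] B) ∈ 𝒯 → Gen 𝒯 A B (replicate (suc k) c)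
  ax-d   : ∀ {A B k} → (A ⊑○[ -[1+ k ] ] B) ∈ 𝒯 → Gen 𝒯 A B (replicate (suc k) d)
  ax-∃   : ∀ {A B C D r w} → (A ⊑∃[ r ] C) ∈ 𝒯 → (∃[ r ] D ⊑ B) ∈ 𝒯 →
           Gen 𝒯 C D w → Gen 𝒯 A B w
  split  : ∀ {A B C u v} → OccursIn C 𝒯 →
           Gen 𝒯 A C u → Gen 𝒯 C B v → Gen 𝒯 A B (u ++ v)

#c : List Letter → ℕ
#c [] = 0
#c (c ∷ w) = suc (#c w)
#c (d ∷ w) = #c w

#d : List Letter → ℕ
#d [] = 0
#d (c ∷ w) = #d w
#d (d ∷ w) = suc (#d w)

-- Soundness: each production of Γ_𝒯 is a valid inference, so a derivation of w from 𝒩_AB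
-- yields 𝒯 ⊨ A ⊑ ○^k B, where k = #c(w) − #d(w) is the weight of w.
-- Completeness: in the canonical model an element (X , j) stands for "an X at time j", and it
-- belongs to B at time t exactly when 𝒩_XB derives a word of weight t − j. Because roles are
-- rigid, the r-successor witnessing A ⊑ ∃r.Y at time i can be taken to be (Y , i) at every time,
-- and the r-edges into (Y , i) remember which A ⊑ ∃r.Y produced them, so ∃r.D ⊑ B becomes
-- the production 𝒩_AB → 𝒩_YD. The element (A , 0) then witnesses completeness.
module Submission where

open import Defs
open import Data.Nat using (ℕ; suc)
open import Data.Integer using (ℤ; +_; -[1+_]; _+_; _-_)
import Data.Integer.Properties as ℤ
open import Data.Integer.Tactic.RingSolver using (solve-∀)
open import Data.List using (List; []; _∷_; _++_; replicate)
open import Data.List.Membership.Propositional using (_∈_)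
open import Data.List.Membership.Propositional.Properties using (∈-concat⁺′; ∈-map⁺)
open import Data.List.Relation.Unary.Any using (here; there)
open import Data.Product using (Σ; _×_; _,_)
open import Function.Bundles using (_⇔_; mk⇔)
open import Relation.Binary.PropositionalEquality using (_≡_; refl; sym; trans; cong; subst)

open Interpretation

letterWeight : Letter → ℤ
letterWeight c = + 1
letterWeight d = -[1+ 0 ]

weight : List Letter → ℤ
weight []      = + 0
weight (a ∷ w) = letterWeight a + weight w

weight-++ : ∀ u v → weight (u ++ v) ≡ weight u + weight v
weight-++ []      v = sym (ℤ.+-identityˡ (weight v))
weight-++ (a ∷ u) v = trans (cong (_+_ (letterWeight a)) (weight-++ u v))
                            (sym (ℤ.+-assoc (letterWeight a) (weight u) (weight v)))

weight-replicate-c : ∀ k → weight (replicate (suc k) c) ≡ + suc k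
weight-replicate-c ℕ.zero  = refl
weight-replicate-c (suc k) = cong (_+_ (+ 1)) (weight-replicate-c k)

weight-replicate-d : ∀ k → weight (replicate (suc k) d) ≡ -[1+ k ]
weight-replicate-d ℕ.zero  = refl
weight-replicate-d (suc k) = cong (_+_ -[1+ 0 ]) (weight-replicate-d k)

weight≡#c-#d : ∀ w → weight w ≡ + #c w - + #d w
weight≡#c-#d []      = refl
weight≡#c-#d (c ∷ w) = trans (cong (_+_ (+ 1)) (weight≡#c-#d w)) (shift (+ #c w) (+ #d w))
  where
  shift : ∀ i j → + 1 + (i - j) ≡ (+ 1 + i) - j
  shift = solve-∀
weight≡#c-#d (d ∷ w) = trans (cong (_+_ -[1+ 0 ]) (weight≡#c-#d w)) (shift (+ #c w) (+ #d w))
  where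
  shift : ∀ i j → -[1+ 0 ] + (i - j) ≡ i - (+ 1 + j)
  shift = solve-∀

Gen-sound : ∀ {𝒯 A B w} → Gen 𝒯 A B w → ∀ I → I ⊨TBox 𝒯 → I ⊨ax (A ⊑○[ weight w ] B)
Gen-sound (ax-ε m) I ⊨𝒯 = ⊨𝒯 m
Gen-sound (refl-ε _) I ⊨𝒯 i x a = subst (λ t → conc I _ t x) (sym (ℤ.+-identityʳ i)) a
Gen-sound (ax-c {k = k} m) I ⊨𝒯 i x a =
  subst (λ t → conc I _ (i + t) x) (sym (weight-replicate-c k)) (⊨𝒯 m i x a)
Gen-sound (ax-d {k = k} m) I ⊨𝒯 i x a =
  subst (λ t → conc I _ (i + t) x) (sym (weight-replicate-d k)) (⊨𝒯 m i x a)
Gen-sound (ax-∃ m⊑∃ m∃⊑ g) I ⊨𝒯 i x a with ⊨𝒯 m⊑∃ i x a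
... | y , xry , y∈C = ⊨𝒯 m∃⊑ _ x y xry (Gen-sound g I ⊨𝒯 i y y∈C)
Gen-sound (split {u = u} {v = v} _ g h) I ⊨𝒯 i x a =
  subst (λ t → conc I _ t x) shift (Gen-sound h I ⊨𝒯 _ x (Gen-sound g I ⊨𝒯 i x a))
  where
  shift : i + weight u + weight v ≡ i + weight (u ++ v)
  shift = trans (ℤ.+-assoc i (weight u) (weight v)) (cong (_+_ i) (sym (weight-++ u v)))

Derives : TBox → ConceptName → ConceptName → ℤ → Set
Derives 𝒯 A B n = Σ (List Letter) λ w → Gen 𝒯 A B w × weight w ≡ n

Derives-sound : ∀ {𝒯 A B n} → Derives 𝒯 A B n → 𝒯 ⊨ (A ⊑○[ n ] B)
Derives-sound (w , g , refl) = Gen-sound g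

module _ {𝒯 : TBox} where

  occursIn-axiom : ∀ {α X} → α ∈ 𝒯 → X ∈ conceptNamesOf α → OccursIn X 𝒯
  occursIn-axiom α∈𝒯 X∈α = ∈-concat⁺′ X∈α (∈-map⁺ conceptNamesOf α∈𝒯)

  Derives-refl : ∀ {A} → OccursIn A 𝒯 → Derives 𝒯 A A (+ 0)
  Derives-refl A∈𝒯 = [] , refl-ε A∈𝒯 , refl

  Derives-trans : ∀ {A B C m n} → OccursIn C 𝒯 →
                  Derives 𝒯 A C m → Derives 𝒯 C B n → Derives 𝒯 A B (m + n)
  Derives-trans C∈𝒯 (u , gu , refl) (v , gv , refl) = u ++ v , split C∈𝒯 gu gv , weight-++ u v

  Derives-∃ : ∀ {A B C D r n} → (A ⊑∃[ r ] C) ∈ 𝒯 → (∃[ r ] D ⊑ B) ∈ 𝒯 →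
              Derives 𝒯 C D n → Derives 𝒯 A B n
  Derives-∃ m⊑∃ m∃⊑ (w , g , e) = w , ax-∃ m⊑∃ m∃⊑ g , e

  Derives-axiom : ∀ {A B n} → (A ⊑○[ n ] B) ∈ 𝒯 → Derives 𝒯 A B n
  Derives-axiom {n = + ℕ.zero} m = [] , ax-ε m , refl
  Derives-axiom {n = + suc k}  m = _ , ax-c m , weight-replicate-c k
  Derives-axiom {n = -[1+ k ]} m = _ , ax-d m , weight-replicate-d k

  Instance : ConceptName → ℤ → ConceptName × ℤ → Set
  Instance B t (X , j) = Derives 𝒯 X B (t - j)

  Edge : RoleName → ConceptName × ℤ → ConceptName × ℤ → Set
  Edge r x (Y , i) = Σ ConceptName λ A → (A ⊑∃[ r ] Y) ∈ 𝒯 × Instance A i x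

  canonical : Interpretation
  canonical = record { Δ = ConceptName × ℤ ; conc = Instance ; role = Edge }

  canonical-⊨TBox : canonical ⊨TBox 𝒯
  canonical-⊨TBox {A ⊑○[ n ] B} m i (X , j) X⊑A =
    subst (Derives 𝒯 X B) (shift i j n)
      (Derives-trans (occursIn-axiom m (here refl)) X⊑A (Derives-axiom m))
    where
    shift : ∀ i j n → (i - j) + n ≡ (i + n) - j
    shift = solve-∀
  canonical-⊨TBox {∃[ r ] D ⊑ B} m i (X , j) (Y , k) (A , m⊑∃ , X⊑A) Y⊑D =
    subst (Derives 𝒯 X B) (trans (ℤ.+-comm (k - j) (i - k)) (ℤ.+-minus-telescope i k j))
      (Derives-trans (occursIn-axiom m⊑∃ (here refl)) X⊑A (Derives-∃ m⊑∃ m Y⊑D))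
  canonical-⊨TBox {A ⊑∃[ r ] Y} m i x x∈A =
    (Y , i) , (A , m , x∈A) ,
    subst (Derives 𝒯 Y Y) (sym (ℤ.+-inverseʳ i)) (Derives-refl (occursIn-axiom m (there (here refl))))

  Derives-complete : ∀ {A B n} → OccursIn A 𝒯 → 𝒯 ⊨ (A ⊑○[ n ] B) → Derives 𝒯 A B n
  Derives-complete {A} {B} {n} A∈𝒯 ⊨A⊑B =
    subst (Derives 𝒯 A B) (trans (ℤ.+-identityʳ (+ 0 + n)) (ℤ.+-identityˡ n))
      (⊨A⊑B canonical canonical-⊨TBox (+ 0) (A , + 0) (Derives-refl A∈𝒯))

lemma4 : (𝒯 : TBox) (A B : ConceptName) → OccursIn A 𝒯 → OccursIn B 𝒯 → (n : ℤ) →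
    (𝒯 ⊨ (A ⊑○[ n ] B)) ⇔ (Σ (List Letter) λ w → Gen 𝒯 A B w × ((+ #c w) - (+ #d w) ≡ n))
lemma4 𝒯 A B A∈𝒯 _ n = mk⇔
  (λ ⊨A⊑B → counting (Derives-complete A∈𝒯 ⊨A⊑B))
  (λ (w , g , e) → Derives-sound (w , g , trans (weight≡#c-#d w) e))
  where
  counting : Derives 𝒯 A B n → Σ (List Letter) λ w → Gen 𝒯 A B w × (+ #c w - + #d w ≡ n)
  counting (w , g , e) = w , g , trans (sym (weight≡#c-#d w)) e
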